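{- Let $G$ be a finite, connected, simple undirected graph with vertices $v_0,\dots,v_n$ and edge set $E$. Let $\mathcal{O}$ be a $G$-semiorientation and let $r=\rho(\mathcal{O})$ be the set of $x\in\mathbb{R}^{n+1}$ with $x_j>x_i+1$ whenever $(v_i,v_j)\in\mathcal{O}$ and $|x_i-x_j|<1$ whenever $\{v_i,v_j\}\in E$ is blank in $\mathcal{O}$. For $t=(t_0,\dots,t_n)\in r$, let $P_t$ be the $G$-semiorder on $\{v_0,\dots,v_n\}$ given by $v_i<v_j$ iff $t_i+1<t_j$ (i.e. the interval order of the intervals $[t_i,t_i+1]$, with $[t_i,t_i+1]$ identified with $v_i$). Then the set $\{P_t: t\in r\}$ is exactly the set of $G$-semiorders compatible with $\mathcal{O}$.
   Context: A partial orientation of $G$ is a subset $\mathcal{O}\subseteq V\times V$ such that if $(u,v)\in\mathcal{O}$ then $\{u,v\}\in E$ and $(v,u)\notin\mathcal{O}$; edges with neither orientation in $\mathcal{O}$ are blank. A cycle of $G$ is a potential cycle for $\mathcal{O}$ if its blank edges can be directed to make it a directed cycle. A $G$-semiorientation is a partial orientation whose every potential cycle has strictly more blank than oriented edges. A semiorder is a poset isomorphic to the order on a finite set of unit closed intervals $[a,a+1]$ with $[a,a+1]<[b,b+1]$ iff $a+1<b$; a $G$-semiorder is a semiorder on the vertex set $V$. A $G$-semiorder $P$ and a $G$-semiorientation $\mathcal{O}$ are compatible if for every edge $\{u,v\}\in E$, $u<v$ in $P$ iff $(u,v)\in\mathcal{O}$.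
   Formalization: The region $r$ is taken in ℚ^(n+1) instead of $\mathbb{R}^{n+1}$, and the endpoints $a$ of the unit intervals in the definition of a semiorder are rational. -}

module Defs where

open import Data.Nat using (ℕ; suc; _≤_)
open import Data.Fin using (Fin)
open import Data.Bool using (Bool; true; false; _∧_; not)
open import Data.List using (List; []; _∷_; _∷ʳ_; length; filter)
open import Data.List.Relation.Unary.All using (All)
open import Data.List.Relation.Unary.Unique.Propositional using (Unique)
open import Data.Product using (Σ; ∃; _×_; _,_)
open import Data.Rational using (ℚ; _+_; _-_; _<_; ∣_∣; 1ℚ)
open import Relation.Binary.PropositionalEquality using (_≡_)
open import Relation.Nullary using (¬_)
open import Relation.Nullary.Decidable using (Dec; yes; no)
open import Data.Bool.Properties using (T?)
open import Data.Bool using (T)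
open import Function.Bundles using (_⇔_)

record Graph (n : ℕ) : Set where
  field
    adj     : Fin (suc n) → Fin (suc n) → Bool
    adj-sym : ∀ u v → adj u v ≡ adj v u
    irrefl  : ∀ v → adj v v ≡ false
open Graph public

data Reachable {n : ℕ} (G : Graph n) : Fin (suc n) → Fin (suc n) → Set where
  here : ∀ {v} → Reachable G v v
  step : ∀ {u w v} → adj G u w ≡ true → Reachable G w v → Reachable G u v

Connected : {n : ℕ} → Graph n → Set
Connected G = ∀ u v → Reachable G u v

record PartialOrientation {n : ℕ} (G : Graph n) : Set where
  field
    O       : Fin (suc n) → Fin (suc n) → Bool
    O-edge  : ∀ u v → O u v ≡ true → adj G u v ≡ true
    O-asym  : ∀ u v → O u v ≡ true → O v u ≡ false
open PartialOrientation public

module _ {n : ℕ} {G : Graph n} (𝒪 : PartialOrientation G) where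
  V : Set
  V = Fin (suc n)

  blank : V → V → Bool
  blank u v = adj G u v ∧ not (O 𝒪 u v) ∧ not (O 𝒪 v u)

  Blank : V → V → Set
  Blank u v = blank u v ≡ true

  consec : List V → List (V × V)
  consec []           = []
  consec (x ∷ [])     = []
  consec (x ∷ y ∷ xs) = (x , y) ∷ consec (y ∷ xs)

  cycleEdges : List V → List (V × V)
  cycleEdges []       = []
  cycleEdges (x ∷ xs) = consec ((x ∷ xs) ∷ʳ x)

  IsCycle : List V → Set
  IsCycle c = (3 ≤ length c) × Unique c
            × All (λ e → adj G (Data.Product.proj₁ e) (Data.Product.proj₂ e) ≡ true) (cycleEdges c)

  -- the cycle, in this traversal direction, can be made a directed cycle by
  -- directing its blank edges: no edge is oriented against the traversal.
  PotentialDir : List V → Set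
  PotentialDir c = All (λ e → O 𝒪 (Data.Product.proj₂ e) (Data.Product.proj₁ e) ≡ false) (cycleEdges c)

  numOriented : List V → ℕ
  numOriented c = length (filter (λ e → T? (O 𝒪 (Data.Product.proj₁ e) (Data.Product.proj₂ e)
                                          Data.Bool.∨ O 𝒪 (Data.Product.proj₂ e) (Data.Product.proj₁ e)))
                                  (cycleEdges c))

  numBlank : List V → ℕ
  numBlank c = length (filter (λ e → T? (blank (Data.Product.proj₁ e) (Data.Product.proj₂ e))) (cycleEdges c))

  -- 𝒪 is a G-semiorientation: every potential cycle has strictly more blank
  -- than oriented edges.  (A cycle is potential iff one of its two traversal
  -- directions is; quantifying over all traversals covers both.)
  IsSemiorientation : Set
  IsSemiorientation = ∀ c → IsCycle c → PotentialDir c → Data.Nat._<_ (numOriented c) (numBlank c)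

  InRegion : (V → ℚ) → Set
  InRegion x = (∀ i j → O 𝒪 i j ≡ true → x i + 1ℚ < x j)
             × (∀ i j → Blank i j → ∣ x i - x j ∣ < 1ℚ)

  Pt : (V → ℚ) → V → V → Set
  Pt t i j = t i + 1ℚ < t j

  Compatible : (V → V → Set) → Set
  Compatible R = ∀ u v → adj G u v ≡ true → (R u v ⇔ (O 𝒪 u v ≡ true))

IsSemiorder : {n : ℕ} → (Fin (suc n) → Fin (suc n) → Set) → Set
IsSemiorder {n} R = ∃ λ (a : Fin (suc n) → ℚ) → ∀ u v → (R u v ⇔ (a u + 1ℚ < a v))

-- A point t of ρ(𝒪) is a unit-interval representation of P_t, and the inequalities
-- defining ρ(𝒪) say precisely that P_t is compatible with 𝒪: the endpoints of an
-- oriented edge are more than 1 apart, those of a blank edge less than 1. Conversely,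
-- a compatible semiorder has some representation a, but a blank edge may have
-- a v = a u + 1 exactly. The finitely many differences a v - a u exceeding 1 all
-- exceed a common m > 1, so dividing a by any s with 1 < s < m represents the same
-- semiorder with no difference equal to 1, and therefore lies in ρ(𝒪).
module Submission where

open import Defs
open import Data.Nat using (ℕ; zero; suc)
open import Data.Fin using (Fin; zero; suc)
open import Data.Integer using (+_; +[1+_]; -[1+_])
open import Data.Rational
open import Data.Rational.Properties
open import Data.Product using (∃; _×_; _,_; proj₁; proj₂)
open import Data.Sum using (_⊎_; inj₁; inj₂)
import Data.Sum as Sum
open import Data.Unit using (tt)
open import Data.Empty using (⊥-elim)
open import Data.Bool using (true; false)
open import Function.Bundles using (_⇔_; mk⇔; Equivalence)
open import Function.Properties.Equivalence using () renaming (trans to ⇔-trans)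
open import Function.Construct.Symmetry using (⇔-sym)
open import Relation.Binary.Definitions using (tri<; tri≈; tri>)
open import Relation.Binary.PropositionalEquality
open import Relation.Nullary using (¬_; Dec; yes; no; contradiction)
open import Algebra.Properties.AbelianGroup +-0-abelianGroup using (xyx⁻¹≈y; ⁻¹-anti-homo‿-)
open import Algebra.Properties.Group +-0-group using (//-rightDividesˡ)

open Equivalence using (to; from)

p<p+1 : ∀ p → p < p + 1ℚ
p<p+1 p = <-respˡ-≡ (+-identityʳ p) (+-monoʳ-< p (positive⁻¹ 1ℚ))

+1<-asym : ∀ {p q} → p + 1ℚ < q → ¬ (q + 1ℚ < p)
+1<-asym {p} {q} p+1<q q+1<p = <-asym p+1<q (<-trans (p<p+1 q) (<-trans q+1<p (p<p+1 p)))

p+[q-p]≡q : ∀ p q → p + (q - p) ≡ q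
p+[q-p]≡q p q = trans (+-comm p (q - p)) (//-rightDividesˡ p q)

p-q<r⇔p<q+r : ∀ {p q r} → p - q < r ⇔ p < q + r
p-q<r⇔p<q+r {p} {q} {r} = mk⇔
  (λ h → <-respˡ-≡ (p+[q-p]≡q q p) (+-monoʳ-< q h))
  (λ h → <-respʳ-≡ (xyx⁻¹≈y q r) (+-monoˡ-< (- q) h))

p+r<q⇒r<q-p : ∀ {p q r} → p + r < q → r < q - p
p+r<q⇒r<q-p {p} {q} {r} h = <-respˡ-≡ (xyx⁻¹≈y p r) (+-monoˡ-< (- p) h)

r≤q-p⇒p+r≤q : ∀ {p q r} → r ≤ q - p → p + r ≤ q
r≤q-p⇒p+r≤q {p} {q} h = ≤-trans (+-monoʳ-≤ p h) (≤-reflexive (p+[q-p]≡q p q))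

∣p∣<q⇔ : ∀ p {q} → ∣ p ∣ < q ⇔ (p < q × - p < q)
∣p∣<q⇔ p {q} = mk⇔ (split p) (join p)
  where
  split : ∀ p → ∣ p ∣ < q → p < q × - p < q
  split (mkℚ (+ 0) _ _)      h = h , h
  split p@(mkℚ +[1+ _ ] _ _) h = h , <-trans (neg<pos (- p) p) h
  split p@(mkℚ -[1+ _ ] _ _) h = <-trans (neg<pos p (- p)) h , h
  join : ∀ p → p < q × - p < q → ∣ p ∣ < q
  join (mkℚ (+ _) _ _)    (p<q , _)  = p<q
  join (mkℚ -[1+ _ ] _ _) (_ , -p<q) = -p<q

∣p-q∣<r⇔ : ∀ {p q r} → ∣ p - q ∣ < r ⇔ (p < q + r × q < p + r)
∣p-q∣<r⇔ {p} {q} {r} = ⇔-trans (∣p∣<q⇔ (p - q)) (mk⇔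
  (λ (h₁ , h₂) → to p-q<r⇔p<q+r h₁
                , to p-q<r⇔p<q+r (<-respˡ-≡ (⁻¹-anti-homo‿- p q) h₂))
  (λ (h₁ , h₂) → from p-q<r⇔p<q+r h₁
                , <-respˡ-≡ (sym (⁻¹-anti-homo‿- p q)) (from p-q<r⇔p<q+r h₂)))

finite-strictLowerBound : ∀ {k} {P : Fin k → Set} → (∀ i → Dec (P i)) →
  (b : ℚ) (g : Fin k → ℚ) → (∀ i → P i → b < g i) → ∃ λ m → b < m × (∀ i → P i → m ≤ g i)
finite-strictLowerBound {zero} P? b g b<g = b + 1ℚ , p<p+1 b , λ ()
finite-strictLowerBound {suc k} P? b g b<g
  with finite-strictLowerBound (λ i → P? (suc i)) b (λ i → g (suc i)) (λ i → b<g (suc i))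
     | P? zero
... | m , b<m , m≤g | no ¬P₀ = m , b<m , λ { zero P₀ → contradiction P₀ ¬P₀ ; (suc i) → m≤g i }
... | m , b<m , m≤g | yes P₀ with ≤-total m (g zero)
...   | inj₁ m≤g₀ = m , b<m , λ { zero _ → m≤g₀ ; (suc i) → m≤g i }
...   | inj₂ g₀≤m =
  g zero , b<g zero P₀ , λ { zero _ → ≤-refl ; (suc i) Pᵢ → ≤-trans g₀≤m (m≤g i Pᵢ) }

finite-strictLowerBound₂ : ∀ {k} {P : Fin k → Fin k → Set} → (∀ u v → Dec (P u v)) →
  (b : ℚ) (g : Fin k → Fin k → ℚ) → (∀ u v → P u v → b < g u v) →
  ∃ λ m → b < m × (∀ u v → P u v → m ≤ g u v)
finite-strictLowerBound₂ {P = P} P? b g b<g =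
  let m , b<m , m≤row = finite-strictLowerBound (λ _ → yes tt) b (λ u → proj₁ (row u))
                                                (λ u _ → proj₁ (proj₂ (row u)))
  in m , b<m , λ u v Puv → ≤-trans (m≤row u tt) (proj₂ (proj₂ (row u)) v Puv)
  where
  row : ∀ u → ∃ λ m → b < m × (∀ v → P u v → m ≤ g u v)
  row u = finite-strictLowerBound (P? u) b (g u) (b<g u)

uniformGap : ∀ {k} (a : Fin k → ℚ) →
  ∃ λ m → 1ℚ < m × (∀ u v → a u + 1ℚ < a v → a u + m ≤ a v)
uniformGap a =
  let m , 1<m , m≤gap = finite-strictLowerBound₂ (λ u v → a u + 1ℚ <? a v) 1ℚ (λ u v → a v - a u)
                                                (λ u v → p+r<q⇒r<q-p)
  in m , 1<m , λ u v h → r≤q-p⇒p+r≤q (m≤gap u v h)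

module _ {m s : ℚ} (1<s : 1ℚ < s) (s<m : s < m) {x y : ℚ} (gap : x + 1ℚ < y → x + m ≤ y) where

  x+s<y⇔x+1<y : x + s < y ⇔ x + 1ℚ < y
  x+s<y⇔x+1<y = mk⇔
    (λ x+s<y → <-trans (+-monoʳ-< x 1<s) x+s<y)
    (λ x+1<y → <-≤-trans (+-monoʳ-< x s<m) (gap x+1<y))

  x+s<y⊎y<x+s : x + s < y ⊎ y < x + s
  x+s<y⊎y<x+s with <-cmp (x + s) y
  ... | tri< x+s<y _ _ = inj₁ x+s<y
  ... | tri> _ _ y<x+s = inj₂ y<x+s
  ... | tri≈ _ refl _  =
    ⊥-elim (<-irrefl refl (<-≤-trans (+-monoʳ-< x s<m) (gap (+-monoʳ-< x 1<s))))

*-<⇔ : ∀ r .{{_ : Positive r}} {p q} → p < q ⇔ r * p < r * q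
*-<⇔ r = mk⇔ (*-monoʳ-<-pos r) (*-cancelˡ-<-nonNeg r {{pos⇒nonNeg r}})

module Rescale (s : ℚ) .{{_ : Positive s}} where
  instance
    s≢0 : NonZero s
    s≢0 = pos⇒nonZero s

    1/s>0 : Positive (1/ s)
    1/s>0 = 1/pos⇒pos s

  1/s*[x+s]≡1/s*x+1 : ∀ x → 1/ s * (x + s) ≡ 1/ s * x + 1ℚ
  1/s*[x+s]≡1/s*x+1 x = trans (*-distribˡ-+ (1/ s) x s) (cong (_+_ (1/ s * x)) (*-inverseˡ s))

  x+s<y⇔1/s*x+1<1/s*y : ∀ {x y} → x + s < y ⇔ 1/ s * x + 1ℚ < 1/ s * y
  x+s<y⇔1/s*x+1<1/s*y {x} {y} =
    subst (λ z → x + s < y ⇔ z < 1/ s * y) (1/s*[x+s]≡1/s*x+1 x) (*-<⇔ (1/ s))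

  y<x+s⇔1/s*y<1/s*x+1 : ∀ {x y} → y < x + s ⇔ 1/ s * y < 1/ s * x + 1ℚ
  y<x+s⇔1/s*y<1/s*x+1 {x} {y} =
    subst (λ z → y < x + s ⇔ 1/ s * y < z) (1/s*[x+s]≡1/s*x+1 x) (*-<⇔ (1/ s))

UnitGeneric : ∀ {A : Set} → (A → ℚ) → Set
UnitGeneric t = ∀ u v → t u + 1ℚ < t v ⊎ t v < t u + 1ℚ

unitGenericRepresentation : ∀ {k} (a : Fin k → ℚ) →
  ∃ λ t → UnitGeneric t × (∀ u v → a u + 1ℚ < a v ⇔ t u + 1ℚ < t v)
unitGenericRepresentation a with uniformGap a
... | m , 1<m , gap with <-dense 1<m
... | s , 1<s , s<m = t , generic , order
  where
  instance
    s>0 : Positive s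
    s>0 = positive (<-trans (positive⁻¹ 1ℚ) 1<s)
  open Rescale s

  t : Fin _ → ℚ
  t u = 1/ s * a u

  generic : UnitGeneric t
  generic u v = Sum.map (to x+s<y⇔1/s*x+1<1/s*y) (to y<x+s⇔1/s*y<1/s*x+1)
                        (x+s<y⊎y<x+s 1<s s<m {a u} {a v} (gap u v))

  order : ∀ u v → a u + 1ℚ < a v ⇔ t u + 1ℚ < t v
  order u v = ⇔-trans (⇔-sym (x+s<y⇔x+1<y 1<s s<m {a u} {a v} (gap u v)))
                      x+s<y⇔1/s*x+1<1/s*y

module _ {n : ℕ} {G : Graph n} (𝒪 : PartialOrientation G) where

  edge-trichotomy : ∀ {u v} → adj G u v ≡ true →
    O 𝒪 u v ≡ true ⊎ O 𝒪 v u ≡ true ⊎ Blank 𝒪 u v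
  edge-trichotomy {u} {v} e with O 𝒪 u v | O 𝒪 v u
  ... | true  | _     = inj₁ refl
  ... | false | true  = inj₂ (inj₁ refl)
  ... | false | false rewrite e = inj₂ (inj₂ refl)

  Blank⇒edge×unoriented : ∀ {u v} → Blank 𝒪 u v →
    adj G u v ≡ true × O 𝒪 u v ≡ false × O 𝒪 v u ≡ false
  Blank⇒edge×unoriented {u} {v} b with adj G u v | O 𝒪 u v | O 𝒪 v u
  Blank⇒edge×unoriented refl | true | false | false = refl , refl , refl

  Compatible-cong : ∀ {R S : V 𝒪 → V 𝒪 → Set} → (∀ u v → R u v ⇔ S u v) →
    Compatible 𝒪 R ⇔ Compatible 𝒪 S
  Compatible-cong R⇔S = mk⇔
    (λ compat u v e → ⇔-trans (⇔-sym (R⇔S u v)) (compat u v e))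
    (λ compat u v e → ⇔-trans (R⇔S u v) (compat u v e))

  InRegion⇒Compatible : ∀ {t} → InRegion 𝒪 t → Compatible 𝒪 (Pt 𝒪 t)
  InRegion⇒Compatible {t} (oriented⇒separated , blank⇒close) u v e =
    mk⇔ separated⇒oriented (oriented⇒separated u v)
    where
    separated⇒oriented : t u + 1ℚ < t v → O 𝒪 u v ≡ true
    separated⇒oriented tu+1<tv with edge-trichotomy e
    ... | inj₁ uv∈𝒪            = uv∈𝒪
    ... | inj₂ (inj₁ vu∈𝒪)     = ⊥-elim (+1<-asym tu+1<tv (oriented⇒separated v u vu∈𝒪))
    ... | inj₂ (inj₂ uv-blank) =
      ⊥-elim (<-asym tu+1<tv (proj₂ (to (∣p-q∣<r⇔ {t u}) (blank⇒close u v uv-blank))))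

  Compatible⇒InRegion : ∀ {t} → UnitGeneric t → Compatible 𝒪 (Pt 𝒪 t) → InRegion 𝒪 t
  Compatible⇒InRegion {t} generic compat = oriented⇒separated , blank⇒close
    where
    oriented⇒separated : ∀ i j → O 𝒪 i j ≡ true → t i + 1ℚ < t j
    oriented⇒separated i j ij∈𝒪 = from (compat i j (O-edge 𝒪 i j ij∈𝒪)) ij∈𝒪

    unoriented⇒close : ∀ {i j} → adj G i j ≡ true → O 𝒪 i j ≡ false → t j < t i + 1ℚ
    unoriented⇒close {i} {j} e ij∉𝒪 with generic i j
    ... | inj₂ tj<ti+1 = tj<ti+1
    ... | inj₁ ti+1<tj with trans (sym (to (compat i j e) ti+1<tj)) ij∉𝒪
    ...   | ()

    blank⇒close : ∀ i j → Blank 𝒪 i j → ∣ t i - t j ∣ < 1ℚ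
    blank⇒close i j ij-blank =
      let e , ij∉𝒪 , ji∉𝒪 = Blank⇒edge×unoriented ij-blank
      in from (∣p-q∣<r⇔ {t i}) ( unoriented⇒close (trans (adj-sym G j i) e) ji∉𝒪
                               , unoriented⇒close e ij∉𝒪)

theorem3p6 : {n : ℕ} (G : Graph n) → Connected G →
    (𝒪 : PartialOrientation G) → IsSemiorientation 𝒪 →
    (R : Fin (suc n) → Fin (suc n) → Set) →
    (∃ λ (t : Fin (suc n) → ℚ) → InRegion 𝒪 t × (∀ u v → R u v ⇔ Pt 𝒪 t u v))
      ⇔ (IsSemiorder R × Compatible 𝒪 R)
theorem3p6 G _ 𝒪 _ R = mk⇔ region⇒semiorder region⇐semiorder
  where
  Represented : Set
  Represented = ∃ λ t → InRegion 𝒪 t × (∀ u v → R u v ⇔ Pt 𝒪 t u v)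

  region⇒semiorder : Represented → IsSemiorder R × Compatible 𝒪 R
  region⇒semiorder (t , t∈ρ , R⇔Pt) =
    (t , R⇔Pt) , from (Compatible-cong 𝒪 R⇔Pt) (InRegion⇒Compatible 𝒪 t∈ρ)

  region⇐semiorder : IsSemiorder R × Compatible 𝒪 R → Represented
  region⇐semiorder ((a , R⇔a) , compat) =
    let t , generic , a⇔t = unitGenericRepresentation a
        R⇔Pt u v = ⇔-trans (R⇔a u v) (a⇔t u v)
    in t , Compatible⇒InRegion 𝒪 generic (to (Compatible-cong 𝒪 R⇔Pt) compat) , R⇔Pt
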